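{- Fix $a,b,k\in\mathbb{N}$. Define $a_1=a$, $a_2=b$, and $a_n=ka_{n-1}+a_{n-2}$ for $n\ge3$. Let $(x_n)_{n\ge1}$ be the sequence $1,1,1,2,2,2,1,1,1,2,2,2,\ldots$ and $(y_n)_{n\ge1}$ the sequence $2,2,2,1,1,1,2,2,2,1,1,1,\ldots$ (blocks of three alternating). (1) If $k$ is even, then $(\Gamma(a_n,a_{n+1}))_{n\ge1}$ is constant. (2) If $k$ is odd: (a) if $a,b$ are both odd, then $(\Gamma(a_n,a_{n+1}))_{n\ge3}$ equals $(x_n)_{n\ge1}$ or $(y_n)_{n\ge1}$; (b) if $a$ is odd and $b$ is even, then $(\Gamma(a_n,a_{n+1}))_{n\ge2}$ equals $(x_n)_{n\ge1}$ or $(y_n)_{n\ge1}$; (c) if $a$ is even and $b$ is odd, then $(\Gamma(a_n,a_{n+1}))_{n\ge1}$ equals $(x_n)_{n\ge1}$ or $(y_n)_{n\ge1}$.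
   Context: $\mathbb{N}$ denotes the positive integers. For coprime $a,b\in\mathbb{N}$, consider the equations (E1) $ax+by=\frac{(a-1)(b-1)}{2}$ and (E2) $ax+by+1=\frac{(a-1)(b-1)}{2}$. We say the pair $(a,b)$ uses (E1) if (E1) has a solution in nonnegative integers $x,y$. For arbitrary $a,b\in\mathbb{N}$ with $d=\gcd(a,b)$, define $\Gamma(a,b)=1$ if the coprime pair $(a/d,b/d)$ uses (E1), and $\Gamma(a,b)=2$ otherwise. -}

module Defs where

open import Data.Nat using (ℕ; zero; suc; _+_; _*_; _∸_; _<_; _≤_; _<?_)
open import Data.Nat.DivMod using (_/_; _%_)
open import Data.Nat.GCD using (gcd)
open import Data.Nat.Coprimality using (Coprime)
open import Data.Product using (Σ; _×_)
open import Data.Sum using (_⊎_)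
open import Relation.Binary.PropositionalEquality using (_≡_)
open import Relation.Nullary using (¬_; yes; no)

-- A coprime pair (a , b) "uses (E1)": a x + b y = (a-1)(b-1)/2 has a
-- solution in nonnegative integers x, y.  Written with the factor 2
-- cleared ((a-1)(b-1) is even for coprime a, b ≥ 1).
UsesE1 : ℕ → ℕ → Set
UsesE1 a b = Σ ℕ λ x → Σ ℕ λ y → 2 * (a * x + b * y) ≡ (a ∸ 1) * (b ∸ 1)

-- m / d with d = gcd a b (the case gcd a b = 0, i.e. a = b = 0, never
-- occurs for positive a, b; we return m unchanged there).
divByGcd : ℕ → ℕ → ℕ → ℕ
divByGcd a b m with gcd a b
... | zero  = m
... | suc d = m / suc d

Γ≡ : ℕ → ℕ → ℕ → Set
Γ≡ a b v =
  (v ≡ 1 × UsesE1 (divByGcd a b a) (divByGcd a b b)) ⊎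
  (v ≡ 2 × ¬ UsesE1 (divByGcd a b a) (divByGcd a b b))

-- The sequence a_n, 0-indexed: seq a b k i = a_{i+1}.
seq : ℕ → ℕ → ℕ → ℕ → ℕ
seq a b k zero = a
seq a b k (suc zero) = b
seq a b k (suc (suc i)) = k * seq a b k (suc i) + seq a b k i

-- x_n and y_n, 0-indexed: xs i = x_{i+1}, ys i = y_{i+1}.
xs : ℕ → ℕ
xs i with (i % 6) <? 3
... | yes _ = 1
... | no _  = 2

ys : ℕ → ℕ
ys i with (i % 6) <? 3
... | yes _ = 2
... | no _  = 1

-- Every pair a, b ≥ 1 can be written as d (α + β , δ + γ) with α β γ δ ∈ ℕ and
-- αδ = 1 + βγ (run the subtractive Euclidean algorithm backwards).  Writing
-- A = α + β, B = δ + γ, the pair (A, B) uses (E1) iff α and δ are both odd: a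
-- solution x, y of (E1) gives A (2x+1) + B (2y+1) = AB + 1 = Aδ + Bα, and since
-- A, B are coprime and 2x+1, δ ≤ B, this forces 2x+1 = δ and then 2y+1 = α.
-- Passing from (a_n, a_{n+1}) to (a_{n+1}, a_{n+2}) replaces the matrix
-- (α β ; γ δ) by (δ γ ; kδ+β kγ+α), so Γ(a_n, a_{n+1}) is read off an orbit in
-- SL₂(𝔽₂).  For even k the map only swaps the diagonal, so Γ is constant; for
-- odd k it is a 6-cycle through SL₂(𝔽₂) along which Γ runs through 1,1,1,2,2,2,
-- and the parities of a and b fix the phase.
module Submission where

open import Algebra.Bundles.Raw using (RawSemiring)
open import Data.Fin.Base using (toℕ)
open import Data.List.Base using (_∷_; [])
open import Data.Nat.Base as ℕ
  using (ℕ; zero; suc; _+_; _*_; _≤_; _<_; z≤n; s≤s; s≤s⁻¹; NonZero;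
         compare; less; equal; greater; parity)
open import Data.Nat.Properties
open import Data.Nat.Coprimality using (Coprime; coprime-divisor; coprime⇒gcd≡1)
import Data.Nat.Coprimality as Coprime
open import Data.Nat.Divisibility
  using (_∣_; divides; _∣0; ∣-refl; ∣⇒≤; m∣m*n; ∣1⇒≡1; ∣m∣n⇒∣m+n; ∣m+n∣m⇒∣n; ∣n⇒∣m*n)
open import Data.Nat.DivMod using (_/_; m*n/n≡m; DivMod; _divMod_)
open import Data.Nat.GCD using (gcd; c*gcd[m,n]≡gcd[cm,cn])
open import Data.Nat.GeneralisedArithmetic using (iterate)
open import Data.Nat.Tactic.RingSolver using (solve)
open import Data.Parity.Base as ℙ using (Parity; 0ℙ; 1ℙ)
open import Data.Parity.Properties using (+-homo-+; *-homo-*)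
import Data.Parity.Properties as ℙ
open import Data.Product using (Σ; ∃-syntax; _×_; _,_; proj₁; proj₂)
open import Data.Sum as Sum using (_⊎_; inj₁; inj₂)
open import Data.Vec.Base using (tabulate; lookup)
open import Data.Vec.Properties using (lookup∘tabulate)
open import Function.Base using (_∘_)
open import Level using (0ℓ)
open import Relation.Nullary using (¬_; contradiction; yes; no)
open import Relation.Binary.PropositionalEquality
open import Defs

2∣⇒parity≡0ℙ : ∀ {n} → 2 ∣ n → parity n ≡ 0ℙ
2∣⇒parity≡0ℙ (divides q refl) = trans (*-homo-* q 2) (ℙ.*-zeroʳ (parity q))

parity≡0ℙ⇒2∣ : ∀ n → parity n ≡ 0ℙ → 2 ∣ n
parity≡0ℙ⇒2∣ zero          _ = 2 ∣0
parity≡0ℙ⇒2∣ (suc zero)    ()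
parity≡0ℙ⇒2∣ (suc (suc n)) h = ∣m∣n⇒∣m+n ∣-refl (parity≡0ℙ⇒2∣ n h)

2∤⇒parity≡1ℙ : ∀ {n} → ¬ 2 ∣ n → parity n ≡ 1ℙ
2∤⇒parity≡1ℙ {n} 2∤n with parity n in eq
... | 1ℙ = refl
... | 0ℙ = contradiction (parity≡0ℙ⇒2∣ n eq) 2∤n

parity≡1ℙ⇒odd : ∀ n → parity n ≡ 1ℙ → ∃[ x ] n ≡ 1 + 2 * x
parity≡1ℙ⇒odd zero          ()
parity≡1ℙ⇒odd (suc zero)    _ = 0 , refl
parity≡1ℙ⇒odd (suc (suc n)) h with parity≡1ℙ⇒odd n h
... | x , refl = suc x , cong (suc ∘ suc) (sym (+-suc x (x + 0)))

parity[1+2x]≡1ℙ : ∀ x → parity (1 + 2 * x) ≡ 1ℙ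
parity[1+2x]≡1ℙ x = trans (+-homo-+ 1 (2 * x)) (cong (1ℙ ℙ.+_) (*-homo-* 2 x))

parity-*+ : ∀ k x y → parity (k * x + y) ≡ (parity k ℙ.* parity x) ℙ.+ parity y
parity-*+ k x y = trans (+-homo-+ (k * x) y) (cong (ℙ._+ parity y) (*-homo-* k x))

record Mat₂ (A : Set) : Set where
  constructor mat
  field
    α β γ δ : A

mapMat : {A B : Set} → (A → B) → Mat₂ A → Mat₂ B
mapMat f (mat α β γ δ) = mat (f α) (f β) (f γ) (f δ)

module Matrices (R : RawSemiring 0ℓ 0ℓ) where
  open RawSemiring R renaming (_+_ to _⊕_; _*_ to _⊗_)

  -- Summing the bottom row as δ ⊕ γ makes top (advance k M) and bottom M
  -- definitionally equal.
  top bottom : Mat₂ Carrier → Carrier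
  top    (mat α β γ δ) = α ⊕ β
  bottom (mat α β γ δ) = δ ⊕ γ

  Unimodular : Mat₂ Carrier → Set
  Unimodular (mat α β γ δ) = α ⊗ δ ≈ 1# ⊕ β ⊗ γ

  advance : Carrier → Mat₂ Carrier → Mat₂ Carrier
  advance k (mat α β γ δ) = mat δ γ (k ⊗ δ ⊕ β) (k ⊗ γ ⊕ α)

open Matrices ℕ.+-*-rawSemiring
module ℙᴹ = Matrices ℙ.+-*-rawSemiring

advance-unimodular : ∀ k M → Unimodular M → Unimodular (advance k M)
advance-unimodular k (mat α β γ δ) det = begin
  δ * (k * γ + α)        ≡⟨ solve (k ∷ α ∷ γ ∷ δ ∷ []) ⟩
  α * δ + k * γ * δ      ≡⟨ cong (_+ k * γ * δ) det ⟩
  1 + β * γ + k * γ * δ  ≡⟨ solve (k ∷ β ∷ γ ∷ δ ∷ []) ⟩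
  1 + γ * (k * δ + β)    ∎
  where open ≡-Reasoning

parity-advance : ∀ k M → mapMat parity (advance k M) ≡ ℙᴹ.advance (parity k) (mapMat parity M)
parity-advance k (mat α β γ δ) = cong₂ (mat (parity δ) (parity γ)) (parity-*+ k δ β) (parity-*+ k γ α)

parity-orbit : ∀ k M i →
  mapMat parity (iterate (advance k) M i) ≡ iterate (ℙᴹ.advance (parity k)) (mapMat parity M) i
parity-orbit k M zero    = refl
parity-orbit k M (suc i) =
  trans (parity-orbit k (advance k M) i) (cong (λ P → iterate _ P i) (parity-advance k M))

unimodular-parity : ∀ M → Unimodular M → ℙᴹ.Unimodular (mapMat parity M)
unimodular-parity (mat α β γ δ) det = begin
  parity α ℙ.* parity δ           ≡⟨ *-homo-* α δ ⟨
  parity (α * δ)                  ≡⟨ cong parity det ⟩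
  parity (1 + β * γ)              ≡⟨ +-homo-+ 1 (β * γ) ⟩
  1ℙ ℙ.+ parity (β * γ)           ≡⟨ cong (1ℙ ℙ.+_) (*-homo-* β γ) ⟩
  1ℙ ℙ.+ (parity β ℙ.* parity γ)  ∎
  where open ≡-Reasoning

u*m≡1+v*n⇒coprime : ∀ {m n} u v → u * m ≡ 1 + v * n → Coprime m n
u*m≡1+v*n⇒coprime {m} {n} u v eq {d} (d∣m , d∣n) =
  ∣1⇒≡1 (∣m+n∣m⇒∣n d∣v*n+1 (∣n⇒∣m*n v d∣n))
  where
  d∣v*n+1 : d ∣ v * n + 1
  d∣v*n+1 = subst (d ∣_) (trans eq (+-comm 1 (v * n))) (∣n⇒∣m*n u d∣m)

unimodular⇒coprime : ∀ M → Unimodular M → Coprime (top M) (bottom M)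
unimodular⇒coprime (mat α β γ δ) det = u*m≡1+v*n⇒coprime δ β (begin
  δ * (α + β)            ≡⟨ solve (α ∷ β ∷ δ ∷ []) ⟩
  α * δ + β * δ          ≡⟨ cong (_+ β * δ) det ⟩
  1 + β * γ + β * δ      ≡⟨ solve (β ∷ γ ∷ δ ∷ []) ⟩
  1 + β * (δ + γ)        ∎)
  where open ≡-Reasoning

coprime-multiple≡0 : ∀ {A B d} → Coprime A B → B ∣ A * d → d < B → d ≡ 0
coprime-multiple≡0 {d = zero}  _ _    _   = refl
coprime-multiple≡0 {d = suc d} c B∣Ad d<B =
  contradiction (∣⇒≤ (coprime-divisor (Coprime.sym c) B∣Ad)) (<⇒≱ d<B)

coprime-representation-ordered : ∀ {A B X Y X′ Y′} → Coprime A B →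
  A * X + B * Y ≡ A * X′ + B * Y′ → X ≤ X′ → X′ < X + B → X ≡ X′
coprime-representation-ordered {A} {B} {X} {Y} {Y′ = Y′} c eq X≤X′ X′<X+B
  with m≤n⇒∃[o]m+o≡n X≤X′
... | d , refl = sym (trans (cong (X +_) d≡0) (+-identityʳ X))
  where
  BY≡BY′+Ad : B * Y ≡ B * Y′ + A * d
  BY≡BY′+Ad = +-cancelˡ-≡ (A * X) _ _ (trans eq (solve (A ∷ B ∷ X ∷ d ∷ Y′ ∷ [])))
  B∣Ad : B ∣ A * d
  B∣Ad = ∣m+n∣m⇒∣n (subst (B ∣_) BY≡BY′+Ad (m∣m*n Y)) (m∣m*n Y′)
  d≡0 : d ≡ 0
  d≡0 = coprime-multiple≡0 c B∣Ad (+-cancelˡ-< X d B X′<X+B)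

coprime-representation-unique : ∀ {A B X Y X′ Y′} → Coprime A B →
  A * X + B * Y ≡ A * X′ + B * Y′ → X < X′ + B → X′ < X + B → X ≡ X′
coprime-representation-unique {X = X} {X′ = X′} c eq X<X′+B X′<X+B with ≤-total X X′
... | inj₁ X≤X′ = coprime-representation-ordered c eq X≤X′ X′<X+B
... | inj₂ X′≤X = sym (coprime-representation-ordered c (sym eq) X′≤X X<X′+B)

coprime⇒gcd[cA,cB]≡c : ∀ {A B} c → Coprime A B → gcd (c * A) (c * B) ≡ c
coprime⇒gcd[cA,cB]≡c {A} {B} c coprime = begin
  gcd (c * A) (c * B) ≡⟨ c*gcd[m,n]≡gcd[cm,cn] c A B ⟨
  c * gcd A B         ≡⟨ cong (c *_) (coprime⇒gcd≡1 coprime) ⟩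
  c * 1               ≡⟨ *-identityʳ c ⟩
  c                   ∎
  where open ≡-Reasoning

divByGcd-scaled : ∀ {A B} d X → Coprime A B → divByGcd (suc d * A) (suc d * B) (suc d * X) ≡ X
divByGcd-scaled d X coprime rewrite coprime⇒gcd[cA,cB]≡c (suc d) coprime =
  trans (cong (_/ suc d) (*-comm (suc d) X)) (m*n/n≡m X (suc d))

odd-diagonal⇒usesE1 : ∀ M → Unimodular M → parity (Mat₂.α M) ≡ 1ℙ → parity (Mat₂.δ M) ≡ 1ℙ →
  UsesE1 (top M) (bottom M)
odd-diagonal⇒usesE1 (mat α β γ δ) det α-odd δ-odd
  with parity≡1ℙ⇒odd α α-odd | parity≡1ℙ⇒odd δ δ-odd
... | y , refl | x , refl = x , y , +-cancelʳ-≡ (1 + β * γ) _ _ (begin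
  2 * ((1 + 2 * y + β) * x + (1 + 2 * x + γ) * y) + (1 + β * γ)
    ≡⟨ solve (β ∷ γ ∷ x ∷ y ∷ []) ⟩
  (2 * y + β) * (2 * x + γ) + (1 + 2 * y) * (1 + 2 * x)
    ≡⟨ cong ((2 * y + β) * (2 * x + γ) +_) det ⟩
  (2 * y + β) * (2 * x + γ) + (1 + β * γ) ∎)
  where open ≡-Reasoning

E1⇒representation : ∀ A′ B′ x y → 2 * (suc A′ * x + suc B′ * y) ≡ A′ * B′ →
  suc A′ * (1 + 2 * x) + suc B′ * (1 + 2 * y) ≡ suc A′ * suc B′ + 1
E1⇒representation A′ B′ x y E = begin
  suc A′ * (1 + 2 * x) + suc B′ * (1 + 2 * y) ≡⟨ solve (A′ ∷ B′ ∷ x ∷ y ∷ []) ⟩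
  2 + A′ + B′ + 2 * (suc A′ * x + suc B′ * y) ≡⟨ cong (2 + A′ + B′ +_) E ⟩
  2 + A′ + B′ + A′ * B′                       ≡⟨ solve (A′ ∷ B′ ∷ []) ⟩
  suc A′ * suc B′ + 1                         ∎
  where open ≡-Reasoning

E1⇒2x≤B′ : ∀ A′ B′ x y → 2 * (suc A′ * x + suc B′ * y) ≡ A′ * B′ → 2 * x ≤ B′
E1⇒2x≤B′ A′ B′ x y E = *-cancelˡ-≤ (suc A′) (begin
  suc A′ * (2 * x)                     ≤⟨ m≤m+n _ _ ⟩
  suc A′ * (2 * x) + 2 * (suc B′ * y)  ≡⟨ solve (A′ ∷ B′ ∷ x ∷ y ∷ []) ⟩
  2 * (suc A′ * x + suc B′ * y)        ≡⟨ E ⟩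
  A′ * B′                              ≤⟨ *-monoˡ-≤ B′ (n≤1+n A′) ⟩
  suc A′ * B′                          ∎)
  where open ≤-Reasoning

unimodular⇒top*bottom+1 : ∀ M → Unimodular M →
  top M * bottom M + 1 ≡ top M * Mat₂.δ M + bottom M * Mat₂.α M
unimodular⇒top*bottom+1 (mat α β γ δ) det = begin
  (α + β) * (δ + γ) + 1                   ≡⟨ solve (α ∷ β ∷ γ ∷ δ ∷ []) ⟩
  (1 + β * γ) + (α * δ + α * γ + β * δ)  ≡⟨ cong (_+ (α * δ + α * γ + β * δ)) det ⟨
  α * δ + (α * δ + α * γ + β * δ)         ≡⟨ solve (α ∷ β ∷ γ ∷ δ ∷ []) ⟩
  (α + β) * δ + (δ + γ) * α               ∎
  where open ≡-Reasoning

usesE1⇒odd-diagonal : ∀ M → Unimodular M → UsesE1 (top M) (bottom M) →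
  parity (Mat₂.α M) ≡ 1ℙ × parity (Mat₂.δ M) ≡ 1ℙ
usesE1⇒odd-diagonal (mat zero    β γ δ)       ()
usesE1⇒odd-diagonal (mat (suc α) β γ zero)    det _ =
  contradiction (trans (sym (*-zeroʳ (suc α))) det) 0≢1+n
usesE1⇒odd-diagonal M@(mat (suc α) β γ (suc δ)) det (x , y , E) =
  subst (λ n → parity n ≡ 1ℙ) Y≡α (parity[1+2x]≡1ℙ y) ,
  subst (λ n → parity n ≡ 1ℙ) X≡δ (parity[1+2x]≡1ℙ x)
  where
  A = suc (α + β)
  B = suc (δ + γ)
  representation : A * (1 + 2 * x) + B * (1 + 2 * y) ≡ A * suc δ + B * suc α
  representation = trans (E1⇒representation (α + β) (δ + γ) x y E) (unimodular⇒top*bottom+1 M det)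
  X≡δ : 1 + 2 * x ≡ suc δ
  X≡δ = coprime-representation-unique (unimodular⇒coprime M det) representation
    (s≤s (≤-trans (s≤s (E1⇒2x≤B′ (α + β) (δ + γ) x y E)) (m≤n+m B δ)))
    (s≤s (≤-trans (s≤s (m≤m+n δ γ)) (m≤n+m B (2 * x))))
  Y≡α : 1 + 2 * y ≡ suc α
  Y≡α = *-cancelˡ-≡ _ _ B (+-cancelˡ-≡ (A * suc δ) _ _
    (trans (cong (λ X → A * X + B * (1 + 2 * y)) (sym X≡δ)) representation))

Γ-value : Mat₂ Parity → ℕ
Γ-value (mat 1ℙ _ _ 1ℙ) = 1
Γ-value _               = 2

Γ-value-dichotomy : ∀ M → Unimodular M →
  (Γ-value (mapMat parity M) ≡ 1 × UsesE1 (top M) (bottom M)) ⊎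
  (Γ-value (mapMat parity M) ≡ 2 × ¬ UsesE1 (top M) (bottom M))
Γ-value-dichotomy M@(mat α β γ δ) det with parity α in α-parity | parity δ in δ-parity
... | 1ℙ | 1ℙ = inj₁ (refl , odd-diagonal⇒usesE1 M det α-parity δ-parity)
... | 0ℙ | _  = inj₂ (refl , λ u →
  contradiction (trans (sym α-parity) (proj₁ (usesE1⇒odd-diagonal M det u))) λ ())
... | 1ℙ | 0ℙ = inj₂ (refl , λ u →
  contradiction (trans (sym δ-parity) (proj₂ (usesE1⇒odd-diagonal M det u))) λ ())

Γ≡-intro : ∀ {a b A B v} → divByGcd a b a ≡ A → divByGcd a b b ≡ B →
  (v ≡ 1 × UsesE1 A B) ⊎ (v ≡ 2 × ¬ UsesE1 A B) → Γ≡ a b v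
Γ≡-intro refl refl Γ = Γ

record Decomposition (a b : ℕ) : Set where
  constructor decomposition
  field
    d          : ℕ
    matrix     : Mat₂ ℕ
    unimodular : Unimodular matrix
    a-scaled   : a ≡ suc d * top matrix
    b-scaled   : b ≡ suc d * bottom matrix

  parities : Mat₂ Parity
  parities = mapMat parity matrix

open Decomposition using (parities)

Γ≡-decomposition : ∀ {a b} (D : Decomposition a b) → Γ≡ a b (Γ-value (parities D))
Γ≡-decomposition (decomposition d M det refl refl) =
  Γ≡-intro {suc d * top M} {suc d * bottom M}
    (divByGcd-scaled d _ coprime) (divByGcd-scaled d _ coprime) (Γ-value-dichotomy M det)
  where coprime = unimodular⇒coprime M det

decomposition-diagonal : ∀ a → Decomposition (suc a) (suc a)
decomposition-diagonal a = decomposition a (mat 1 0 0 1) refl a≡ a≡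
  where a≡ = sym (*-identityʳ (suc a))

add-top-to-bottom : ∀ {a b} → Decomposition a b → Decomposition a (a + b)
add-top-to-bottom (decomposition d (mat α β γ δ) det refl refl) =
  decomposition d (mat α β (γ + α) (δ + β)) det′ refl b′
  where
  b′ : suc d * (α + β) + suc d * (δ + γ) ≡ suc d * ((δ + β) + (γ + α))
  b′ = solve (d ∷ α ∷ β ∷ γ ∷ δ ∷ [])
  det′ : α * (δ + β) ≡ 1 + β * (γ + α)
  det′ = begin
    α * (δ + β)          ≡⟨ solve (α ∷ β ∷ δ ∷ []) ⟩
    α * δ + β * α        ≡⟨ cong (_+ β * α) det ⟩
    1 + β * γ + β * α    ≡⟨ solve (α ∷ β ∷ γ ∷ []) ⟩
    1 + β * (γ + α)      ∎
    where open ≡-Reasoning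

add-bottom-to-top : ∀ {a b} → Decomposition a b → Decomposition (b + a) b
add-bottom-to-top (decomposition d (mat α β γ δ) det refl refl) =
  decomposition d (mat (α + γ) (β + δ) γ δ) det′ a′ refl
  where
  a′ : suc d * (δ + γ) + suc d * (α + β) ≡ suc d * ((α + γ) + (β + δ))
  a′ = solve (d ∷ α ∷ β ∷ γ ∷ δ ∷ [])
  det′ : (α + γ) * δ ≡ 1 + (β + δ) * γ
  det′ = begin
    (α + γ) * δ          ≡⟨ solve (α ∷ γ ∷ δ ∷ []) ⟩
    α * δ + δ * γ        ≡⟨ cong (_+ δ * γ) det ⟩
    1 + β * γ + δ * γ    ≡⟨ solve (β ∷ γ ∷ δ ∷ []) ⟩
    1 + (β + δ) * γ      ∎
    where open ≡-Reasoning

decompose : ∀ {a b} → 1 ≤ a → 1 ≤ b → Decomposition a b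
decompose {suc a} {suc b} (s≤s z≤n) (s≤s z≤n) = bounded (suc (a + b)) a b ≤-refl
  where
  bounded : ∀ n a b → a + b < n → Decomposition (suc a) (suc b)
  bounded (suc n) a b a+b<1+n with compare a b
  ... | equal a = decomposition-diagonal a
  ... | less a k = subst (Decomposition (suc a)) (cong suc (+-suc a k))
    (add-top-to-bottom (bounded n a k (≤-trans (+-monoʳ-< a (s≤s (m≤n+m k a))) (s≤s⁻¹ a+b<1+n))))
  ... | greater b k = subst (λ c → Decomposition c (suc b)) (cong suc (+-suc b k))
    (add-bottom-to-top (bounded n k b (≤-trans (s≤s (+-monoˡ-≤ b (m≤n+m k b))) (s≤s⁻¹ a+b<1+n))))

advance-decomposition : ∀ {a b} k → Decomposition a b → Decomposition b (k * b + a)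
advance-decomposition k (decomposition d M@(mat α β γ δ) det refl refl) =
  decomposition d (advance k M) (advance-unimodular k M det) refl c
  where
  c : k * (suc d * (δ + γ)) + suc d * (α + β) ≡ suc d * ((k * γ + α) + (k * δ + β))
  c = solve (d ∷ k ∷ α ∷ β ∷ γ ∷ δ ∷ [])

seq-suc : ∀ a b k i → seq a b k (suc i) ≡ seq b (k * b + a) k i
seq-suc a b k zero          = refl
seq-suc a b k (suc zero)    = refl
seq-suc a b k (suc (suc i)) = cong₂ (λ x y → k * x + y) (seq-suc a b k (suc i)) (seq-suc a b k i)

Γ≡-seq-suc : ∀ {a b k i v} → Γ≡ (seq b (k * b + a) k i) (seq b (k * b + a) k (suc i)) v →
  Γ≡ (seq a b k (suc i)) (seq a b k (2 + i)) v
Γ≡-seq-suc {a} {b} {k} {i} = subst₂ (λ x y → Γ≡ x y _) (sym (seq-suc a b k i)) (sym (seq-suc a b k (suc i)))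

ΓFrom : ℕ → ℕ → ℕ → ℕ → (ℕ → ℕ) → Set
ΓFrom a b k o f = ∀ i → Γ≡ (seq a b k (o + i)) (seq a b k (suc (o + i))) (f i)

Γ≡-orbit : ∀ {a b} k (D : Decomposition a b) →
  ΓFrom a b k 0 (Γ-value ∘ mapMat parity ∘ iterate (advance k) (Decomposition.matrix D))
Γ≡-orbit k D zero = Γ≡-decomposition D
-- Matching on D makes the matrix of advance-decomposition k D compute to advance k M.
Γ≡-orbit k D@(decomposition _ (mat _ _ _ _) _ refl refl) (suc i) =
  Γ≡-seq-suc {i = i} (Γ≡-orbit k (advance-decomposition k D) i)

Γ≡-parity-orbit : ∀ {a b} k (D : Decomposition a b) →
  ΓFrom a b k 0 (Γ-value ∘ iterate (ℙᴹ.advance (parity k)) (parities D))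
Γ≡-parity-orbit {a} {b} k D i =
  subst (Γ≡ (seq a b k i) (seq a b k (suc i)))
    (cong Γ-value (parity-orbit k (Decomposition.matrix D) i)) (Γ≡-orbit k D i)

Γ-value-advance-0ℙ : ∀ P → Γ-value (ℙᴹ.advance 0ℙ P) ≡ Γ-value P
Γ-value-advance-0ℙ (mat 0ℙ _ _ 0ℙ) = refl
Γ-value-advance-0ℙ (mat 0ℙ _ _ 1ℙ) = refl
Γ-value-advance-0ℙ (mat 1ℙ _ _ 0ℙ) = refl
Γ-value-advance-0ℙ (mat 1ℙ _ _ 1ℙ) = refl

Γ-value-iterate-0ℙ : ∀ P i → Γ-value (iterate (ℙᴹ.advance 0ℙ) P i) ≡ Γ-value P
Γ-value-iterate-0ℙ P zero    = refl
Γ-value-iterate-0ℙ P (suc i) = trans (Γ-value-iterate-0ℙ (ℙᴹ.advance 0ℙ P) i) (Γ-value-advance-0ℙ P)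

Γ-constant : ∀ {a b} k → parity k ≡ 0ℙ → Decomposition a b → Σ ℕ λ c → ΓFrom a b k 0 (λ _ → c)
Γ-constant {a} {b} k k-even D = Γ-value (parities D) , λ i →
  subst (Γ≡ (seq a b k i) (seq a b k (suc i)))
    (trans (cong (λ p → Γ-value (iterate (ℙᴹ.advance p) (parities D) i)) k-even)
           (Γ-value-iterate-0ℙ (parities D) i))
    (Γ≡-parity-orbit k D i)

Periodic : {A : Set} → ℕ → (ℕ → A) → Set
Periodic n f = ∀ i → f (n + i) ≡ f i

periodic-*+ : ∀ {A : Set} {n} {f : ℕ → A} → Periodic n f → ∀ q r → f (q * n + r) ≡ f r
periodic-*+         p zero    r = refl
periodic-*+ {n = n} {f} p (suc q) r =
  trans (cong f (+-assoc n (q * n) r)) (trans (p (q * n + r)) (periodic-*+ p q r))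

-- Agreement over one period is an equation of vectors, so that for concrete
-- functions it holds by refl.
periodic-≗ : ∀ {A : Set} n .{{_ : NonZero n}} {f g : ℕ → A} → Periodic n f → Periodic n g →
  tabulate {n = n} (f ∘ toℕ) ≡ tabulate (g ∘ toℕ) → ∀ i → f i ≡ g i
periodic-≗ n {f} {g} f-periodic g-periodic same i = begin
  f i                               ≡⟨ to-remainder f-periodic ⟩
  f (toℕ r)                         ≡⟨ lookup∘tabulate (f ∘ toℕ) r ⟨
  lookup (tabulate (f ∘ toℕ)) r     ≡⟨ cong (λ v → lookup v r) same ⟩
  lookup (tabulate (g ∘ toℕ)) r     ≡⟨ lookup∘tabulate (g ∘ toℕ) r ⟩
  g (toℕ r)                         ≡⟨ to-remainder g-periodic ⟨
  g i                               ∎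
  where
  open ≡-Reasoning
  open DivMod (i divMod n) renaming (remainder to r)
  to-remainder : ∀ {h : ℕ → _} → Periodic n h → h i ≡ h (toℕ r)
  to-remainder {h} h-periodic =
    trans (cong h (trans property (+-comm (toℕ r) _))) (periodic-*+ h-periodic quotient (toℕ r))

xs-periodic : Periodic 6 xs
xs-periodic i with i ℕ.% 6 <? 3
... | yes _ = refl
... | no _  = refl

ys-periodic : Periodic 6 ys
ys-periodic i with i ℕ.% 6 <? 3
... | yes _ = refl
... | no _  = refl

Γ-orbit-1ℙ : ∀ P → ℙᴹ.Unimodular P → ℙᴹ.top P ≡ 0ℙ → ℙᴹ.bottom P ≡ 1ℙ →
  (∀ i → Γ-value (iterate (ℙᴹ.advance 1ℙ) P i) ≡ xs i) ⊎
  (∀ i → Γ-value (iterate (ℙᴹ.advance 1ℙ) P i) ≡ ys i)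
Γ-orbit-1ℙ (mat 0ℙ 0ℙ _  _)  ()
Γ-orbit-1ℙ (mat 0ℙ 1ℙ _  _)  _ ()
Γ-orbit-1ℙ (mat 1ℙ 0ℙ _  _)  _ ()
Γ-orbit-1ℙ (mat 1ℙ 1ℙ 0ℙ 0ℙ) _ _ ()
Γ-orbit-1ℙ (mat 1ℙ 1ℙ 0ℙ 1ℙ) _ _ _ = inj₁ (periodic-≗ 6 (λ _ → refl) xs-periodic refl)
Γ-orbit-1ℙ (mat 1ℙ 1ℙ 1ℙ 0ℙ) _ _ _ = inj₂ (periodic-≗ 6 (λ _ → refl) ys-periodic refl)
Γ-orbit-1ℙ (mat 1ℙ 1ℙ 1ℙ 1ℙ) _ _ ()

scaled-parities : ∀ {a b} (D : Decomposition a b) →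
  let s = parity (suc (Decomposition.d D)) in
  parity a ≡ s ℙ.* ℙᴹ.top (parities D) × parity b ≡ s ℙ.* ℙᴹ.bottom (parities D)
scaled-parities (decomposition d (mat α β γ δ) _ refl refl) =
  trans (*-homo-* (suc d) (α + β)) (cong (parity (suc d) ℙ.*_) (+-homo-+ α β)) ,
  trans (*-homo-* (suc d) (δ + γ)) (cong (parity (suc d) ℙ.*_) (+-homo-+ δ γ))

Alternating : ℕ → ℕ → ℕ → ℕ → Set
Alternating a b k o = ΓFrom a b k o xs ⊎ ΓFrom a b k o ys

alternating-suc : ∀ {a b k o} → Alternating b (k * b + a) k o → Alternating a b k (suc o)
alternating-suc {a} {b} {k} {o} = Sum.map (shift {o} {xs}) (shift {o} {ys})
  where
  shift : ∀ {o f} → ΓFrom b (k * b + a) k o f → ΓFrom a b k (suc o) f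
  shift {o} Γs i = Γ≡-seq-suc {a} {b} {k} {o + i} (Γs i)

alternating-even-odd : ∀ {a b} k → 1 ≤ a → 1 ≤ b → parity k ≡ 1ℙ → parity a ≡ 0ℙ → parity b ≡ 1ℙ →
  Alternating a b k 0
alternating-even-odd {a} {b} k 1≤a 1≤b k-odd a-even b-odd
  with D ← decompose 1≤a 1≤b
  with parity (suc (Decomposition.d D)) | scaled-parities D
... | 0ℙ | _ , b≡0ℙ = contradiction (trans (sym b-odd) b≡0ℙ) λ ()
... | 1ℙ | a≡top , b≡bottom = Sum.map along along
  (Γ-orbit-1ℙ (parities D) (unimodular-parity (Decomposition.matrix D) (Decomposition.unimodular D))
    (trans (sym a≡top) a-even) (trans (sym b≡bottom) b-odd))
  where
  along : ∀ {f} → (∀ i → Γ-value (iterate (ℙᴹ.advance 1ℙ) (parities D) i) ≡ f i) → ΓFrom a b k 0 f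
  along same i = subst (Γ≡ (seq a b k i) (seq a b k (suc i)))
    (trans (cong (λ p → Γ-value (iterate (ℙᴹ.advance p) (parities D) i)) k-odd) (same i))
    (Γ≡-parity-orbit k D i)

alternating-odd-even : ∀ {a b} k → 1 ≤ a → 1 ≤ b → parity k ≡ 1ℙ → parity a ≡ 1ℙ → parity b ≡ 0ℙ →
  Alternating a b k 1
alternating-odd-even {a} {b} k 1≤a 1≤b k-odd a-odd b-even =
  alternating-suc {a} {b} {k} {0}
    (alternating-even-odd k 1≤b (≤-trans 1≤a (m≤n+m a (k * b))) k-odd b-even next-odd)
  where
  next-odd : parity (k * b + a) ≡ 1ℙ
  next-odd rewrite parity-*+ k b a | k-odd | b-even | a-odd = refl

alternating-odd-odd : ∀ {a b} k → 1 ≤ a → 1 ≤ b → parity k ≡ 1ℙ → parity a ≡ 1ℙ → parity b ≡ 1ℙ →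
  Alternating a b k 2
alternating-odd-odd {a} {b} k 1≤a 1≤b k-odd a-odd b-odd =
  alternating-suc {a} {b} {k} {1}
    (alternating-odd-even k 1≤b (≤-trans 1≤a (m≤n+m a (k * b))) k-odd b-odd next-even)
  where
  next-even : parity (k * b + a) ≡ 0ℙ
  next-even rewrite parity-*+ k b a | k-odd | b-odd | a-odd = refl

corollary5p3 : (a b k : ℕ) → 1 ≤ a → 1 ≤ b → 1 ≤ k →
    (2 ∣ k → Σ ℕ λ c → (i : ℕ) → Γ≡ (seq a b k i) (seq a b k (suc i)) c)
    × (¬ 2 ∣ k →
        ((¬ 2 ∣ a → ¬ 2 ∣ b →
          ((i : ℕ) → Γ≡ (seq a b k (2 + i)) (seq a b k (3 + i)) (xs i))
          ⊎ ((i : ℕ) → Γ≡ (seq a b k (2 + i)) (seq a b k (3 + i)) (ys i)))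
        × (¬ 2 ∣ a → 2 ∣ b →
          ((i : ℕ) → Γ≡ (seq a b k (1 + i)) (seq a b k (2 + i)) (xs i))
          ⊎ ((i : ℕ) → Γ≡ (seq a b k (1 + i)) (seq a b k (2 + i)) (ys i)))
        × (2 ∣ a → ¬ 2 ∣ b →
          ((i : ℕ) → Γ≡ (seq a b k i) (seq a b k (1 + i)) (xs i))
          ⊎ ((i : ℕ) → Γ≡ (seq a b k i) (seq a b k (1 + i)) (ys i)))))
corollary5p3 a b k 1≤a 1≤b _ =
  (λ 2∣k → Γ-constant k (2∣⇒parity≡0ℙ 2∣k) (decompose 1≤a 1≤b)) ,
  λ 2∤k → let k-odd = 2∤⇒parity≡1ℙ 2∤k in
    (λ 2∤a 2∤b → alternating-odd-odd k 1≤a 1≤b k-odd (2∤⇒parity≡1ℙ 2∤a) (2∤⇒parity≡1ℙ 2∤b)) ,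
    (λ 2∤a 2∣b → alternating-odd-even k 1≤a 1≤b k-odd (2∤⇒parity≡1ℙ 2∤a) (2∣⇒parity≡0ℙ 2∣b)) ,
    (λ 2∣a 2∤b → alternating-even-odd k 1≤a 1≤b k-odd (2∣⇒parity≡0ℙ 2∣a) (2∤⇒parity≡1ℙ 2∤b))
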